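{- Let $n=3k+2$ with $k\ge 1$ an integer, and let $P_n$ be the path $v_1-v_2-\cdots-v_{n-1}-v_n$. Then no $\gamma$-set of $P_n$ contains the vertex $v_3$.
   Context: All graphs are finite and simple. For a graph $G=(V,E)$, a set $S\subseteq V$ is a dominating set if every vertex of $V\setminus S$ is adjacent to some vertex of $S$. The domination number $\gamma(G)$ is the minimum cardinality of a dominating set; a dominating set of cardinality $\gamma(G)$ is called a $\gamma$-set. -}

module Defs where

open import Data.Nat using (ℕ; suc; _≤_)
open import Data.Fin using (Fin; toℕ)
open import Data.Fin.Subset using (Subset; _∈_; ∣_∣)
open import Data.Product using (Σ; _×_; ∃-syntax)
open import Data.Sum using (_⊎_)
open import Relation.Binary.PropositionalEquality using (_≡_)

record Graph (n : ℕ) : Set₁ where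
  field
    Adj : Fin n → Fin n → Set

open Graph public

Dominating : ∀ {n} → Graph n → Subset n → Set
Dominating {n} G S = (v : Fin n) → v ∈ S ⊎ (∃[ u ] (u ∈ S × Adj G v u))

IsGammaSet : ∀ {n} → Graph n → Subset n → Set
IsGammaSet {n} G S = Dominating G S × ((T : Subset n) → Dominating G T → ∣ S ∣ ≤ ∣ T ∣)

-- The path P_n : v_1 - v_2 - ... - v_n.  Vertex v_i is represented by the
-- element of Fin n with toℕ equal to i - 1; v_i ~ v_j iff |i - j| = 1.
Path : (n : ℕ) → Graph n
Path n = record { Adj = λ i j → (suc (toℕ i) ≡ toℕ j) ⊎ (suc (toℕ j) ≡ toℕ i) }

{-# OPTIONS --safe #-}
module Submission where

-- Read a vertex subset of P_n as a bit vector. S dominates P_n iff the window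
-- of three bits centred at each position (padded with 0 at both ends)
-- contains a 1.
-- Counting windows gives n ≤ 3∣S∣; if v₃ ∈ S then v₁ still needs v₁ or v₂
-- while v₄ is already dominated, which sharpens this to n + 2 ≤ 3∣S∣.
-- Conversely v₂, v₅, v₈, … dominate P_n, so 3γ(P_n) ≤ n + 2. For n = 3k + 2
-- a γ-set containing v₃ would thus satisfy 3∣S∣ = 3k + 4, which is impossible.

open import Defs
open import Data.Bool using (Bool; true; false; T; _∨_)
open import Data.Bool.Properties using (T-∨)
open import Data.Fin using (Fin; toℕ; zero; suc)
open import Data.Fin.Subset using (Subset; _∈_; _∉_; ∣_∣)
open import Data.Nat using (ℕ; suc; _+_; _*_; _≤_; z≤n; s≤s)
open import Data.Nat.Divisibility using (_∣_; divides; ∣m+n∣m⇒∣n; m∣m*n)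
open import Data.Nat.Properties
open import Data.Product using (Σ-syntax; _×_; _,_; ∃-syntax)
open import Data.Sum using (_⊎_; inj₁; inj₂; fromInj₁; map; map₂)
open import Data.Unit using (⊤; tt)
open import Data.Vec using ([]; _∷_; here; there)
open import Function using (_∘_)
open import Function.Bundles using (Equivalence)
open import Relation.Binary.PropositionalEquality using (_≡_; refl; cong; sym; subst)
open import Relation.Nullary using (¬_)

Path-Adj-suc⁺ : ∀ {n} {u v : Fin n} → Adj (Path n) u v → Adj (Path (suc n)) (suc u) (suc v)
Path-Adj-suc⁺ = map (cong suc) (cong suc)

Path-Adj-suc⁻ : ∀ {n} {u v : Fin n} → Adj (Path (suc n)) (suc u) (suc v) → Adj (Path n) u v
Path-Adj-suc⁻ = map suc-injective suc-injective

-- p says whether an extra vertex v₀, adjacent to v₁ only, is in the set.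
DominatedAfter : ∀ {n} → Bool → Subset n → Fin n → Set
DominatedAfter {n} p S v = (v ∈ S ⊎ ∃[ u ] (u ∈ S × Adj (Path n) v u)) ⊎ (toℕ v ≡ 0 × T p)

DominatingAfter : ∀ {n} → Bool → Subset n → Set
DominatingAfter {n} p S = (v : Fin n) → DominatedAfter p S v

DominatedAfter-suc⁺ : ∀ {n} p x (S : Subset n) {v} →
  DominatedAfter x S v → DominatedAfter p (x ∷ S) (suc v)
DominatedAfter-suc⁺ p x S (inj₁ (inj₁ v∈S))           = inj₁ (inj₁ (there v∈S))
DominatedAfter-suc⁺ p x S (inj₁ (inj₂ (u , u∈S , vu))) =
  inj₁ (inj₂ (suc u , there u∈S , Path-Adj-suc⁺ vu))
DominatedAfter-suc⁺ p true S (inj₂ (v≡0 , _))         =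
  inj₁ (inj₂ (zero , here , inj₂ (cong suc (sym v≡0))))
DominatedAfter-suc⁺ p false S (inj₂ (_ , ()))

DominatedAfter-suc⁻ : ∀ {n} p x (S : Subset n) {v} →
  DominatedAfter p (x ∷ S) (suc v) → DominatedAfter x S v
DominatedAfter-suc⁻ p x S (inj₁ (inj₁ (there v∈S)))                 = inj₁ (inj₁ v∈S)
DominatedAfter-suc⁻ p x S (inj₁ (inj₂ (suc u , there u∈S , vu)))    =
  inj₁ (inj₂ (u , u∈S , Path-Adj-suc⁻ vu))
DominatedAfter-suc⁻ p x S (inj₁ (inj₂ (zero , here , inj₂ 1≡1+v))) = inj₂ (sym (suc-injective 1≡1+v) , tt)
DominatedAfter-suc⁻ p x S (inj₁ (inj₂ (zero , _ , inj₁ ())))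

next : ∀ {n} → Subset n → Bool
next []      = false
next (x ∷ _) = x

Covered : ∀ {n} → Bool → Subset n → Set
Covered p []      = ⊤
Covered p (x ∷ S) = T (p ∨ x ∨ next S) × Covered x S

DominatedAfter-zero⁻ : ∀ {n} p x (S : Subset n) →
  DominatedAfter p (x ∷ S) zero → T p ⊎ T x ⊎ T (next S)
DominatedAfter-zero⁻ p x S (inj₁ (inj₁ here))                           = inj₂ (inj₁ tt)
DominatedAfter-zero⁻ p x S (inj₁ (inj₂ (suc zero , there here , _)))    = inj₂ (inj₂ tt)
DominatedAfter-zero⁻ p x S (inj₁ (inj₂ (zero , _ , inj₁ ())))
DominatedAfter-zero⁻ p x S (inj₁ (inj₂ (suc (suc _) , _ , inj₁ ())))
DominatedAfter-zero⁻ p x S (inj₁ (inj₂ (_ , _ , inj₂ ())))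
DominatedAfter-zero⁻ p x S (inj₂ (_ , t))                               = inj₁ t

DominatedAfter-zero⁺ : ∀ {n} p x (S : Subset n) →
  T (p ∨ x ∨ next S) → DominatedAfter p (x ∷ S) zero
DominatedAfter-zero⁺ p true S _               = inj₁ (inj₁ here)
DominatedAfter-zero⁺ p false (true ∷ S) _     = inj₁ (inj₂ (suc zero , there here , inj₁ refl))
DominatedAfter-zero⁺ true false [] _          = inj₂ (refl , tt)
DominatedAfter-zero⁺ true false (false ∷ S) _ = inj₂ (refl , tt)
DominatedAfter-zero⁺ false false [] ()
DominatedAfter-zero⁺ false false (false ∷ S) ()

DominatingAfter⇒Covered : ∀ {n} p (S : Subset n) → DominatingAfter p S → Covered p S
DominatingAfter⇒Covered p []      D = tt
DominatingAfter⇒Covered p (x ∷ S) D =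
  T-∨³ (DominatedAfter-zero⁻ p x S (D zero)) ,
  DominatingAfter⇒Covered x S (DominatedAfter-suc⁻ p x S ∘ D ∘ suc)
  where
  T-∨³ : ∀ {a b c} → T a ⊎ T b ⊎ T c → T (a ∨ b ∨ c)
  T-∨³ = Equivalence.from T-∨ ∘ map₂ (Equivalence.from T-∨)

Covered⇒DominatingAfter : ∀ {n} p (S : Subset n) → Covered p S → DominatingAfter p S
Covered⇒DominatingAfter p (x ∷ S) (c , _) zero    = DominatedAfter-zero⁺ p x S c
Covered⇒DominatingAfter p (x ∷ S) (_ , C) (suc v) =
  DominatedAfter-suc⁺ p x S (Covered⇒DominatingAfter x S C v)

Dominating⇒Covered : ∀ {n} (S : Subset n) → Dominating (Path n) S → Covered false S
Dominating⇒Covered S D = DominatingAfter⇒Covered false S (inj₁ ∘ D)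

Covered⇒Dominating : ∀ {n} (S : Subset n) → Covered false S → Dominating (Path n) S
Covered⇒Dominating S C = fromInj₁ (λ { (_ , ()) }) ∘ Covered⇒DominatingAfter false S C

3+3n≡3[1+n] : ∀ n → 3 + 3 * n ≡ 3 * suc n
3+3n≡3[1+n] n = sym (*-suc 3 n)

mutual
  Covered⇒n≤3∣S∣ : ∀ {n} (S : Subset n) → Covered false S → n ≤ 3 * ∣ S ∣
  Covered⇒n≤3∣S∣ []                 _           = z≤n
  Covered⇒n≤3∣S∣ (true ∷ S)         (_ , C)     =
    ≤-trans (s≤s (m≤n⇒m≤1+n (Covered-true⇒n≤1+3∣S∣ S C))) (≤-reflexive (3+3n≡3[1+n] ∣ S ∣))
  Covered⇒n≤3∣S∣ (false ∷ true ∷ S) (_ , _ , C) =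
    ≤-trans (s≤s (s≤s (Covered-true⇒n≤1+3∣S∣ S C))) (≤-reflexive (3+3n≡3[1+n] ∣ S ∣))
  Covered⇒n≤3∣S∣ (false ∷ false ∷ S) (() , _)
  Covered⇒n≤3∣S∣ (false ∷ [])        (() , _)

  Covered-true⇒n≤1+3∣S∣ : ∀ {n} (S : Subset n) → Covered true S → n ≤ suc (3 * ∣ S ∣)
  Covered-true⇒n≤1+3∣S∣ []         _       = z≤n
  Covered-true⇒n≤1+3∣S∣ (true ∷ S) (_ , C) =
    s≤s (≤-trans (Covered-true⇒n≤1+3∣S∣ S C) (≤-trans (m≤n+m _ 2) (≤-reflexive (3+3n≡3[1+n] ∣ S ∣))))
  Covered-true⇒n≤1+3∣S∣ (false ∷ S) (_ , C) = s≤s (Covered⇒n≤3∣S∣ S C)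

Covered∧v₃∈S⇒n+2≤3∣S∣ : ∀ {n} (S : Subset n) (v : Fin n) →
  Covered false S → v ∈ S → toℕ v ≡ 2 → n + 2 ≤ 3 * ∣ S ∣
Covered∧v₃∈S⇒n+2≤3∣S∣ {suc (suc (suc m))} (a ∷ b ∷ .true ∷ S) (suc (suc zero))
  (a∨b , _ , _ , C) (there (there here)) refl = begin
    3 + (m + 2)          ≡⟨ cong (3 +_) (+-comm m 2) ⟩
    5 + m                ≤⟨ +-monoʳ-≤ 5 (Covered-true⇒n≤1+3∣S∣ S C) ⟩
    3 + (3 + 3 * ∣ S ∣)  ≡⟨ cong (3 +_) (3+3n≡3[1+n] ∣ S ∣) ⟩
    3 + 3 * suc ∣ S ∣    ≡⟨ 3+3n≡3[1+n] (suc ∣ S ∣) ⟩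
    3 * (2 + ∣ S ∣)      ≤⟨ *-monoʳ-≤ 3 (2+∣S∣≤∣a∷b∷true∷S∣ a b a∨b) ⟩
    3 * ∣ a ∷ b ∷ true ∷ S ∣ ∎
  where
  open ≤-Reasoning
  2+∣S∣≤∣a∷b∷true∷S∣ : ∀ a b → T (a ∨ b) → 2 + ∣ S ∣ ≤ ∣ a ∷ b ∷ true ∷ S ∣
  2+∣S∣≤∣a∷b∷true∷S∣ true  true  _ = n≤1+n _
  2+∣S∣≤∣a∷b∷true∷S∣ true  false _ = ≤-refl
  2+∣S∣≤∣a∷b∷true∷S∣ false true  _ = ≤-refl

everyThirdCover : ∀ n → Σ[ T ∈ Subset n ] Covered false T × 3 * ∣ T ∣ ≤ n + 2
everyThirdCover 0 = [] , tt , z≤n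
everyThirdCover 1 = true ∷ [] , (tt , tt) , ≤-refl
everyThirdCover 2 = true ∷ false ∷ [] , (tt , tt , tt) , n≤1+n 3
everyThirdCover (suc (suc (suc n))) with everyThirdCover n
... | R , C , 3∣R∣≤n+2 =
  false ∷ true ∷ false ∷ R , (tt , tt , tt , C) ,
  ≤-trans (≤-reflexive (sym (3+3n≡3[1+n] ∣ R ∣))) (s≤s (s≤s (s≤s 3∣R∣≤n+2)))

3∤3k+4 : ∀ k → ¬ 3 ∣ 3 * k + 4
3∤3k+4 k 3∣3k+4 with ∣m+n∣m⇒∣n 3∣3k+4 (m∣m*n k)
... | divides (suc (suc _)) ()

lemma2p6 : (k : ℕ) → 1 ≤ k → (S : Subset (3 * k + 2)) → IsGammaSet (Path (3 * k + 2)) S →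
    (v₃ : Fin (3 * k + 2)) → toℕ v₃ ≡ 2 → v₃ ∉ S
lemma2p6 k _ S (S-dominating , S-minimum) v₃ v₃≡2 v₃∈S with everyThirdCover (3 * k + 2)
... | R , R-covered , 3∣R∣≤n+2 = 3∤3k+4 k (subst (3 ∣_) 3∣S∣≡3k+4 (m∣m*n ∣ S ∣))
  where
  open ≤-Reasoning
  n+2≡3k+4 : 3 * k + 2 + 2 ≡ 3 * k + 4
  n+2≡3k+4 = +-assoc (3 * k) 2 2
  3∣S∣≡3k+4 : 3 * ∣ S ∣ ≡ 3 * k + 4
  3∣S∣≡3k+4 = ≤-antisym
    (begin
      3 * ∣ S ∣        ≤⟨ *-monoʳ-≤ 3 (S-minimum R (Covered⇒Dominating R R-covered)) ⟩
      3 * ∣ R ∣        ≤⟨ 3∣R∣≤n+2 ⟩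
      3 * k + 2 + 2    ≡⟨ n+2≡3k+4 ⟩
      3 * k + 4        ∎)
    (begin
      3 * k + 4        ≡⟨ sym n+2≡3k+4 ⟩
      3 * k + 2 + 2    ≤⟨ Covered∧v₃∈S⇒n+2≤3∣S∣ S v₃ (Dominating⇒Covered S S-dominating) v₃∈S v₃≡2 ⟩
      3 * ∣ S ∣        ∎)
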